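{- Let $\mathcal{P}=(Q,f)$ be a polymatroid and let $\mathcal{P}'=(QZ,g)$ be an extension of $\mathcal{P}$. Let $X,Y\subseteq Q$ and $\bar{X}=\mathrm{cl}_{\mathcal{P}}(X)$. Then $g(X|Z)=g(X|Y)$ if and only if $g(\bar{X}|Z)=g(\bar{X}|Y)$.
   Context: A polymatroid is a pair $(Q,f)$ with $Q$ finite and $f:\mathcal{P}(Q)\to\mathbb{R}$ satisfying $f(\emptyset)=0$, monotonicity, and submodularity. An extension of $(Q,f)$ is a polymatroid $(QZ,g)$ with $Q\cap Z=\emptyset$ and $g(X)=f(X)$ for all $X\subseteq Q$. Write $AB=A\cup B$ and $g(A|B)=g(AB)-g(B)$. The closure is $\mathrm{cl}_{\mathcal{P}}(X)=\{x\in Q: f(X\cup\{x\})=f(X)\}$. -}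

module Defs where

open import Level using (Level; suc; _⊔_)
open import Data.Nat using (ℕ) renaming (_+_ to _+ℕ_)
open import Data.Fin using (Fin)
open import Data.Vec using (_++_)
open import Data.Fin.Subset using (Subset; _⊆_; _∪_; _∩_; _∈_; ⁅_⁆; ⊥; ⊤)
open import Relation.Binary.PropositionalEquality using (_≡_)
open import Relation.Binary.Structures using (IsTotalOrder)
open import Algebra.Structures using (IsAbelianGroup)
open import Function.Bundles using (_⇔_)
open import Data.Product using (_×_)

-- The paper's polymatroids are real-valued; ℝ is an instance of this
-- record, so stating the lemma for every such group covers the real case.
record OrderedAbelianGroup (c ℓ : Level) : Set (suc (c ⊔ ℓ)) where
  infixl 6 _+_ _-_
  infix 4 _≤_
  field
    Carrier        : Set c
    _+_            : Carrier → Carrier → Carrier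
    0#             : Carrier
    -_             : Carrier → Carrier
    _≤_            : Carrier → Carrier → Set ℓ
    isAbelianGroup : IsAbelianGroup _≡_ _+_ 0# -_
    isTotalOrder   : IsTotalOrder _≡_ _≤_
    +-monoˡ-≤      : ∀ {x y} z → x ≤ y → x + z ≤ y + z

  _-_ : Carrier → Carrier → Carrier
  x - y = x + (- y)

module _ {c ℓ : Level} (G : OrderedAbelianGroup c ℓ) where
  open OrderedAbelianGroup G

  record IsPolymatroid {n : ℕ} (f : Subset n → Carrier) : Set (c ⊔ ℓ) where
    field
      normalized : f ⊥ ≡ 0#
      monotone   : ∀ {A B : Subset n} → A ⊆ B → f A ≤ f B
      submodular : ∀ (A B : Subset n) → f (A ∪ B) + f (A ∩ B) ≤ f A + f B

  cond : {k : ℕ} → (Subset k → Carrier) → Subset k → Subset k → Carrier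
  cond g A B = g (A ∪ B) - g B

  -- The ground set of an extension is QZ = Fin (n + m): the first n
  -- elements form Q, the last m form Z.  A subset X ⊆ Q is lifted to QZ.
  liftQ : {n m : ℕ} → Subset n → Subset (n +ℕ m)
  liftQ {n} {m} X = X ++ ⊥ {m}

  Zset : {n m : ℕ} → Subset (n +ℕ m)
  Zset {n} {m} = ⊥ {n} ++ ⊤ {m}

  IsExtension : {n m : ℕ} → (Subset n → Carrier) → (Subset (n +ℕ m) → Carrier) → Set (c ⊔ ℓ)
  IsExtension {n} {m} f g = IsPolymatroid g × (∀ (X : Subset n) → g (liftQ {n} {m} X) ≡ f X)


  IsClosure : {n : ℕ} → (Subset n → Carrier) → Subset n → Subset n → Set c
  IsClosure {n} f X C = ∀ (x : Fin n) → (x ∈ C) ⇔ (f (X ∪ ⁅ x ⁆) ≡ f X)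

-- By submodularity, if A ⊆ B and h A = h B then h (A ∪ W) = h (B ∪ W)
-- for every W: adding W to the larger set gains no more than adding it to the
-- smaller one.  Adjoining the elements of cl(X) to X one at a time, this shows
-- f (cl X) = f X.  In the extension g the lifts of X ⊆ cl X then have equal
-- value, so g (X ∪ W) = g (cl X ∪ W) for every W, and the conditionals g(X|B)
-- and g(cl X|B) coincide for every B, in particular for B = Z and B = Y.
module Submission where

open import Defs
open import Level using (Level)
open import Data.Nat using (ℕ; _+_)
open import Data.Fin.Subset using (Subset)
open import Relation.Binary.PropositionalEquality using (_≡_)
open import Function.Bundles using (_⇔_)

open import Data.Fin using (Fin)
open import Data.Fin.Subset using (_⊆_; _∪_; _∩_; _∈_; ⁅_⁆; ⊥; ⋃)
open import Data.Fin.Subset.Properties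
  using (_∈?_; x∈⁅x⁆; x∈⁅y⁆⇒x≡y; p⊆p∪q; q⊆p∪q; x∈p∪q⁻; x∈p∩q⁺; drop-∷-⊆;
         ⊆-refl; ⊆-antisym; ∪-assoc; ∪-identityʳ)
open import Data.Vec using ([]; _∷_; _++_; here; there)
open import Data.List using (List; []; _∷_; map; filter; allFin)
open import Data.List.Membership.Propositional using () renaming (_∈_ to _∈ᴸ_)
open import Data.List.Membership.Propositional.Properties using (∈-allFin; ∈-filter⁺)
open import Data.List.Relation.Unary.All using (All; []; _∷_)
import Data.List.Relation.Unary.All as All
open import Data.List.Relation.Unary.All.Properties using (all-filter)
open import Data.List.Relation.Unary.Any using (here; there)
open import Data.Sum using ([_,_])
open import Data.Product using (_,_)
open import Function.Base using (_∘_)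
open import Function.Bundles using (mk⇔; Equivalence)
open import Relation.Binary.PropositionalEquality
  using (refl; sym; trans; cong; subst; subst₂; module ≡-Reasoning)
open import Algebra.Structures using (IsAbelianGroup)
open import Relation.Binary.Structures using (IsTotalOrder)

private
  variable
    k n m : ℕ

∪-lub : {A B C : Subset k} → A ⊆ C → B ⊆ C → A ∪ B ⊆ C
∪-lub {A = A} {B} A⊆C B⊆C = [ A⊆C , B⊆C ] ∘ x∈p∪q⁻ A B

∪-monoˡ-⊆ : {A B : Subset k} (W : Subset k) → A ⊆ B → A ∪ W ⊆ B ∪ W
∪-monoˡ-⊆ {B = B} W A⊆B = ∪-lub (p⊆p∪q W ∘ A⊆B) (q⊆p∪q B W)

x∈A⇒A∪⁅x⁆≡A : {A : Subset k} {x : Fin k} → x ∈ A → A ∪ ⁅ x ⁆ ≡ A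
x∈A⇒A∪⁅x⁆≡A {A = A} {x} x∈A =
  ⊆-antisym (∪-lub ⊆-refl (λ y∈⁅x⁆ → subst (_∈ A) (sym (x∈⁅y⁆⇒x≡y x y∈⁅x⁆)) x∈A))
            (p⊆p∪q ⁅ x ⁆)

x∈L⇒x∈⋃⁅L⁆ : {x : Fin k} {L : List (Fin k)} → x ∈ᴸ L → x ∈ ⋃ (map ⁅_⁆ L)
x∈L⇒x∈⋃⁅L⁆ {x = x} {L = _ ∷ L} (here refl) = p⊆p∪q (⋃ (map ⁅_⁆ L)) (x∈⁅x⁆ x)
x∈L⇒x∈⋃⁅L⁆ {L = y ∷ _}         (there x∈L) = q⊆p∪q ⁅ y ⁆ _ (x∈L⇒x∈⋃⁅L⁆ x∈L)

++-monoˡ-⊆ : {p q : Subset n} (r : Subset m) → p ⊆ q → p ++ r ⊆ q ++ r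
++-monoˡ-⊆ {p = []}    {[]}    r p⊆q x∈r       = x∈r
++-monoˡ-⊆ {p = _ ∷ _} {_ ∷ _} r p⊆q here      with p⊆q here
... | here = here
++-monoˡ-⊆ {p = _ ∷ _} {_ ∷ _} r p⊆q (there x) = there (++-monoˡ-⊆ r (drop-∷-⊆ p⊆q) x)

module _ {c ℓ : Level} (G : OrderedAbelianGroup c ℓ) where
  open OrderedAbelianGroup G renaming (_+_ to _⊕_)
  open IsAbelianGroup isAbelianGroup using (assoc; comm; inverseʳ; identityʳ)
  open IsTotalOrder isTotalOrder using (antisym)
    renaming (trans to ≤-trans; ≲-respˡ-≈ to ≤-respˡ-≡; ≲-respʳ-≈ to ≤-respʳ-≡)

  +-monoʳ-≤ : ∀ {x y} z → x ≤ y → z ⊕ x ≤ z ⊕ y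
  +-monoʳ-≤ {x} {y} z x≤y = subst₂ _≤_ (comm x z) (comm y z) (+-monoˡ-≤ z x≤y)

  +-cancelʳ-≤ : ∀ {x y} z → x ⊕ z ≤ y ⊕ z → x ≤ y
  +-cancelʳ-≤ {x} {y} z x⊕z≤y⊕z = subst₂ _≤_ (w⊕z-z≡w x) (w⊕z-z≡w y) (+-monoˡ-≤ (- z) x⊕z≤y⊕z)
    where
    w⊕z-z≡w : ∀ w → w ⊕ z - z ≡ w
    w⊕z-z≡w w = trans (assoc w z (- z)) (trans (cong (w ⊕_) (inverseʳ z)) (identityʳ w))

  module _ {h : Subset k → Carrier} (isPoly : IsPolymatroid G h) where
    open IsPolymatroid isPoly

    ∪-preserves-equal-rank : {A B : Subset k} → A ⊆ B → h A ≡ h B →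
                             ∀ W → h (A ∪ W) ≡ h (B ∪ W)
    ∪-preserves-equal-rank {A} {B} A⊆B hA≡hB W =
      antisym (monotone (∪-monoˡ-⊆ W A⊆B)) (≤-trans (monotone B∪W⊆B∪A∪W) B∪A∪W≤A∪W)
      where
      B∪W⊆B∪A∪W : B ∪ W ⊆ B ∪ (A ∪ W)
      B∪W⊆B∪A∪W = ∪-lub (p⊆p∪q (A ∪ W)) (q⊆p∪q B (A ∪ W) ∘ q⊆p∪q A W)

      hB≤h[B∩A∪W] : h B ≤ h (B ∩ (A ∪ W))
      hB≤h[B∩A∪W] = ≤-respˡ-≡ hA≡hB
        (monotone (λ x∈A → x∈p∩q⁺ (A⊆B x∈A , p⊆p∪q W x∈A)))

      B∪A∪W≤A∪W : h (B ∪ (A ∪ W)) ≤ h (A ∪ W)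
      B∪A∪W≤A∪W = +-cancelʳ-≤ (h B) (≤-trans
        (+-monoʳ-≤ (h (B ∪ (A ∪ W))) hB≤h[B∩A∪W])
        (≤-respʳ-≡ (comm (h B) (h (A ∪ W))) (submodular B (A ∪ W))))

    ∪-⋃-rank-neutral : {A : Subset k} {L : List (Fin k)} → All (λ x → h (A ∪ ⁅ x ⁆) ≡ h A) L →
                       h (A ∪ ⋃ (map ⁅_⁆ L)) ≡ h A
    ∪-⋃-rank-neutral {A = A} [] = cong h (∪-identityʳ A)
    ∪-⋃-rank-neutral {A = A} {x ∷ L} (neutral ∷ rest) = begin
      h (A ∪ (⁅ x ⁆ ∪ S))  ≡⟨ cong h (sym (∪-assoc A ⁅ x ⁆ S)) ⟩
      h ((A ∪ ⁅ x ⁆) ∪ S)  ≡⟨ sym (∪-preserves-equal-rank (p⊆p∪q ⁅ x ⁆) (sym neutral) S) ⟩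
      h (A ∪ S)            ≡⟨ ∪-⋃-rank-neutral rest ⟩
      h A                  ∎
      where
      open ≡-Reasoning
      S : Subset k
      S = ⋃ (map ⁅_⁆ L)

  closure-⊇ : {f : Subset k → Carrier} {X C : Subset k} → IsClosure G f X C → X ⊆ C
  closure-⊇ {f = f} cl {x} x∈X = Equivalence.from (cl x) (cong f (x∈A⇒A∪⁅x⁆≡A x∈X))

  closure-rank : {f : Subset k → Carrier} → IsPolymatroid G f →
                 {X C : Subset k} → IsClosure G f X C → f C ≡ f X
  closure-rank {k} {f} isPoly {X} {C} cl =
    antisym (≤-respʳ-≡ (∪-⋃-rank-neutral isPoly neutral) (monotone C⊆X∪⋃L))
            (monotone (closure-⊇ {f = f} cl))
    where
    open IsPolymatroid isPoly
    L : List (Fin k)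
    L = filter (_∈? C) (allFin k)

    neutral : All (λ x → f (X ∪ ⁅ x ⁆) ≡ f X) L
    neutral = All.map (Equivalence.to (cl _)) (all-filter (_∈? C) (allFin k))

    C⊆X∪⋃L : C ⊆ X ∪ ⋃ (map ⁅_⁆ L)
    C⊆X∪⋃L x∈C = q⊆p∪q X _ (x∈L⇒x∈⋃⁅L⁆ (∈-filter⁺ (_∈? C) (∈-allFin _) x∈C))

lemma4p4 : {c ℓ : Level} (G : OrderedAbelianGroup c ℓ) {n m : ℕ}
    (f : Subset n → OrderedAbelianGroup.Carrier G)
    (g : Subset (n + m) → OrderedAbelianGroup.Carrier G) →
    IsPolymatroid G f → IsExtension G {n} {m} f g →
    (X Y Xbar : Subset n) → IsClosure G f X Xbar →
    (cond G g (liftQ G X) (Zset G {n} {m}) ≡ cond G g (liftQ G X) (liftQ G Y))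
      ⇔ (cond G g (liftQ G Xbar) (Zset G {n} {m}) ≡ cond G g (liftQ G Xbar) (liftQ G Y))
lemma4p4 G {n} {m} f g isPolyF (isPolyG , extends) X Y Xbar cl =
  mk⇔ (subst₂ _≡_ (same-cond Z) (same-cond (liftQ G Y)))
      (subst₂ _≡_ (sym (same-cond Z)) (sym (same-cond (liftQ G Y))))
  where
  open OrderedAbelianGroup G using (_-_)
  Z : Subset (n + m)
  Z = Zset G {n} {m}

  lift-equal-rank : g (liftQ G X) ≡ g (liftQ G Xbar)
  lift-equal-rank = trans (extends X) (trans (sym (closure-rank G isPolyF cl)) (sym (extends Xbar)))

  same-cond : ∀ B → cond G g (liftQ G X) B ≡ cond G g (liftQ G Xbar) B
  same-cond B = cong (_- g B)
    (∪-preserves-equal-rank G isPolyG (++-monoˡ-⊆ _ (closure-⊇ G {f = f} cl)) lift-equal-rank B)
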